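{- Any range-minimum data structure in the encoding model for arrays of length $n$ that contain $r$ runs must occupy at least $\lg N_{n,r}\ge 2\lg\binom nr-O(\log n)$ bits of space, where $N_{n,r}=\frac1n\binom nr\binom n{r-1}$ are the Narayana numbers.
   Context: For an array $A[1..n]$, a run is a maximal contiguous index range $[j_i,j_{i+1}-1]$ with $A[j_i]\le A[j_i+1]\le\cdots\le A[j_{i+1}-1]$; $A$ has $r$ runs if it splits into exactly $r$ such ranges. A range-minimum query $\mathrm{RMQ}(i,j)$ returns the index of the (leftmost) minimum of $A[i..j]$. In the encoding model the data structure must answer all such queries without access to $A$; the lower bound is on the number of bits needed to distinguish all such arrays that differ in some query answer. -}

module Defs where

open import Data.Nat using (ℕ; zero; suc; _+_; _*_; _<ᵇ_)
open import Data.Nat.DivMod using (_/_)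
open import Data.Nat.Combinatorics using (_C_)
open import Data.Bool using (if_then_else_)
open import Data.Fin as Fin using (Fin)
open import Data.Vec using (Vec; lookup; toList)
open import Data.List using (List; []; _∷_)
open import Data.Product using (_×_)

-- An array A[1..n] of naturals is a Vec ℕ n (0-based indices Fin n).

descents : List ℕ → ℕ
descents (x ∷ y ∷ xs) = (if y <ᵇ x then 1 else 0) + descents (y ∷ xs)
descents _ = 0

-- Number of runs (maximal nondecreasing contiguous ranges): 0 for the
-- empty array, otherwise (number of descents) + 1, since runs break
-- exactly at descents.
runsL : List ℕ → ℕ
runsL [] = 0
runsL xs@(_ ∷ _) = suc (descents xs)

runs : ∀ {n} → Vec ℕ n → ℕ
runs A = runsL (toList A)

IsRMQ : ∀ {n} → Vec ℕ n → Fin n → Fin n → Fin n → Set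
IsRMQ A i j k =
  (i Fin.≤ k × k Fin.≤ j)
  × (∀ (l : Fin _) → i Fin.≤ l → l Fin.≤ j → lookup A k Data.Nat.≤ lookup A l)
  × (∀ (l : Fin _) → i Fin.≤ l → l Fin.< k → lookup A k Data.Nat.< lookup A l)
  where import Data.Nat

-- Narayana numbers N_{n,r} = (1/n) C(n,r) C(n,r-1)  (set to 0 for n = 0).
narayana : ℕ → ℕ → ℕ
narayana zero r = 0
narayana (suc m) r = ((suc m C r) * (suc m C (r Data.Nat.∸ 1))) / suc m
  where import Data.Nat

module Submission where

-- Words of length n + 1 over ℕ with sum n and r zeros number C(n+1, r) C(n-1, r-1) = (n+1) N(n,r).
-- By the cycle lemma each such word has a rotation c whose prefixes of length l ≤ n sum to at least l.
-- The array A[j] = c₀ + ⋯ + c_j + (n − 1 − j) then has exactly r runs, never drops by more than one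
-- and ends at its minimum, and such arrays are determined by their RMQ answers.  So the rotation
-- offset together with the encoding is injective on the words: (n+1) N(n,r) ≤ (n+1) 2^s.
-- The second part, C(n,r)² ≤ n² N(n,r), amounts to C(n,r) ≤ n C(n,r-1).

open import Defs
open import Data.Bool using (Bool; true; false; T; if_then_else_)
open import Data.Bool.Properties using (T-≡)
open import Data.Empty using (⊥-elim)
open import Data.Fin as Fin using (Fin; toℕ; fromℕ<; splitAt; join; combine)
open import Data.Fin.Properties using (toℕ-injective; toℕ-fromℕ<; join-splitAt; combine-injective; injective⇒≤)
open import Data.List using (List; []; _∷_; length; applyUpTo)
open import Data.List.Properties using (∷-injective)
open import Data.Nat
open import Data.Nat.Combinatorics using (_C_; nCn≡1; nCk+nC[k+1]≡[n+1]C[k+1])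
open import Data.Nat.DivMod using (m*n/n≡m)
open import Data.Nat.ListAction using (sum)
open import Data.Nat.Properties
open import Algebra.Properties.CommutativeSemigroup *-commutativeSemigroup using (x∙yz≈y∙xz)
open import Data.Nat.Tactic.RingSolver using (solve-∀; solve)
open import Data.Product using (_×_; _,_; proj₁; proj₂; ∃; ∃-syntax)
open import Data.Sum using (inj₁; inj₂; [_,_])
open import Data.Unit using (tt)
open import Data.Vec as Vec using (Vec; tabulate; toList; lookup)
open import Data.Vec.Properties using (lookup∘tabulate)
open import Function using (_∘_)
open import Function.Bundles using (Equivalence)
open import Function.Definitions using (Injective)
open import Relation.Binary.PropositionalEquality hiding ([_])
open import Relation.Nullary using (yes; no; ¬_)
open import Relation.Nullary.Decidable using (_×-dec_)
open import Relation.Unary using (Decidable)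

paths : ℕ → ℕ → ℕ
paths zero b = 1
paths (suc a) zero = 1
paths (suc a) (suc b) = paths a (suc b) + paths (suc a) b

paths-zeroʳ : ∀ a → paths a 0 ≡ 1
paths-zeroʳ zero = refl
paths-zeroʳ (suc a) = refl

paths-oneˡ : ∀ b → paths 1 b ≡ suc b
paths-oneˡ zero = refl
paths-oneˡ (suc b) = cong suc (paths-oneˡ b)

paths-sym : ∀ a b → paths a b ≡ paths b a
paths-sym zero zero = refl
paths-sym zero (suc b) = refl
paths-sym (suc a) zero = refl
paths-sym (suc a) (suc b) =
  trans (cong₂ _+_ (paths-sym a (suc b)) (paths-sym (suc a) b)) (+-comm (paths (suc b) a) (paths b (suc a)))

C≡paths : ∀ a b → (a + b) C a ≡ paths a b
C≡paths zero b = refl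
C≡paths (suc a) zero rewrite +-identityʳ a = nCn≡1 (suc a)
C≡paths (suc a) (suc b) = begin
    suc (a + suc b) C suc a
  ≡⟨ nCk+nC[k+1]≡[n+1]C[k+1] (a + suc b) a ⟨
    (a + suc b) C a + (a + suc b) C suc a
  ≡⟨ cong₂ _+_ (C≡paths a (suc b)) (trans (cong (_C suc a) (+-suc a b)) (C≡paths (suc a) b)) ⟩
    paths a (suc b) + paths (suc a) b
  ∎
  where open ≡-Reasoning

suc-*-paths-sucˡ : ∀ a b → suc a * paths (suc a) b ≡ suc (a + b) * paths a b
suc-*-paths-sucˡ a zero rewrite paths-zeroʳ a | +-identityʳ a = refl
suc-*-paths-sucˡ zero (suc b) rewrite paths-oneˡ b = *-comm 1 (suc (suc b))
suc-*-paths-sucˡ (suc a) (suc b) = begin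
    suc (suc a) * (x + y + z)
  ≡⟨ shuffle a x y z ⟩
    (x + y) + suc a * (x + y) + suc (suc a) * z
  ≡⟨ cong₂ (λ p q → (x + y) + p + q) (suc-*-paths-sucˡ a (suc b)) (suc-*-paths-sucˡ (suc a) b) ⟩
    (x + y) + suc (a + suc b) * x + suc (suc a + b) * y
  ≡⟨ collect a b x y ⟩
    suc (suc a + suc b) * (x + y)
  ∎
  where
    open ≡-Reasoning
    x = paths a (suc b)
    y = paths (suc a) b
    z = paths (suc (suc a)) b
    shuffle : ∀ a x y z → suc (suc a) * (x + y + z) ≡ (x + y) + suc a * (x + y) + suc (suc a) * z
    shuffle = solve-∀
    collect : ∀ a b x y → (x + y) + suc (a + suc b) * x + suc (suc a + b) * y ≡ suc (suc a + suc b) * (x + y)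
    collect = solve-∀

suc-*-paths-sucʳ : ∀ a b → suc b * paths a (suc b) ≡ suc (a + b) * paths a b
suc-*-paths-sucʳ a b = begin
    suc b * paths a (suc b)
  ≡⟨ cong (suc b *_) (paths-sym a (suc b)) ⟩
    suc b * paths (suc b) a
  ≡⟨ suc-*-paths-sucˡ b a ⟩
    suc (b + a) * paths b a
  ≡⟨ cong₂ _*_ (cong suc (+-comm b a)) (paths-sym b a) ⟩
    suc (a + b) * paths a b
  ∎
  where open ≡-Reasoning

cross-multiply : ∀ a b P m u v w →
  suc a * v ≡ P * m → suc b * w ≡ P * m → suc a * u ≡ suc P * w → P * (u * m) ≡ suc P * (v * w)
cross-multiply a b P m u v w av bw au = *-cancelʳ-≡ _ _ (suc a * suc b) (trans lhs (sym rhs))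
  where
    open ≡-Reasoning
    lhs : P * (u * m) * (suc a * suc b) ≡ suc P * (P * m) * (P * m)
    lhs = begin
        P * (u * m) * (suc a * suc b)
      ≡⟨ solve (P ∷ u ∷ m ∷ a ∷ b ∷ []) ⟩
        P * m * (suc b * (suc a * u))
      ≡⟨ cong (λ q → P * m * (suc b * q)) au ⟩
        P * m * (suc b * (suc P * w))
      ≡⟨ solve (P ∷ m ∷ b ∷ w ∷ []) ⟩
        suc P * (P * m) * (suc b * w)
      ≡⟨ cong (suc P * (P * m) *_) bw ⟩
        suc P * (P * m) * (P * m)
      ∎
    rhs : suc P * (v * w) * (suc a * suc b) ≡ suc P * (P * m) * (P * m)
    rhs = begin
        suc P * (v * w) * (suc a * suc b)
      ≡⟨ solve (P ∷ v ∷ w ∷ a ∷ b ∷ []) ⟩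
        suc P * (suc a * v) * (suc b * w)
      ≡⟨ cong₂ (λ p q → suc P * p * q) av bw ⟩
        suc P * (P * m) * (P * m)
      ∎

narayana-cross : ∀ a b →
  suc (a + b) * (paths (suc a) (suc b) * paths a b) ≡ suc (suc (a + b)) * (paths (suc a) b * paths a (suc b))
narayana-cross a b = cross-multiply a b (suc (a + b)) (paths a b) (paths (suc a) (suc b)) _ _
  (suc-*-paths-sucˡ a b) (suc-*-paths-sucʳ a b)
  (trans (suc-*-paths-sucˡ a (suc b)) (cong (λ c → suc c * paths a (suc b)) (+-suc a b)))

isZero : ℕ → ℕ
isZero zero = 1
isZero (suc _) = 0

zeros : List ℕ → ℕ
zeros [] = 0
zeros (x ∷ xs) = isZero x + zeros xs

HasProfile : ℕ → ℕ → ℕ → List ℕ → Set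
HasProfile z k e xs = length xs ≡ z + k × sum xs ≡ k + e × zeros xs ≡ z

-- #profile⁺ counts the words of the profile whose first entry is positive.
#profile #profile⁺ : ℕ → ℕ → ℕ → ℕ
#profile zero zero zero = 1
#profile zero zero (suc e) = 0
#profile zero (suc k) e = #profile⁺ zero (suc k) e
#profile (suc z) k e = #profile z k e + #profile⁺ (suc z) k e
#profile⁺ z zero e = 0
#profile⁺ z (suc k) zero = #profile z k zero
#profile⁺ z (suc k) (suc e) = #profile z k (suc e) + #profile⁺ z (suc k) e

sucHead : ℕ × List ℕ → List ℕ
sucHead (h , t) = suc h ∷ t

bumpHead : ℕ × List ℕ → ℕ × List ℕ
bumpHead (h , t) = suc h , t

enumerate : ∀ z k e → Fin (#profile z k e) → List ℕ
enumerate⁺ : ∀ z k e → Fin (#profile⁺ z k e) → ℕ × List ℕ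
enumerate zero zero zero _ = []
enumerate zero (suc k) e i = sucHead (enumerate⁺ zero (suc k) e i)
enumerate (suc z) k e i = [ (0 ∷_) ∘ enumerate z k e , sucHead ∘ enumerate⁺ (suc z) k e ] (splitAt (#profile z k e) i)
enumerate⁺ z (suc k) zero i = 0 , enumerate z k zero i
enumerate⁺ z (suc k) (suc e) i =
  [ (0 ,_) ∘ enumerate z k (suc e) , bumpHead ∘ enumerate⁺ z (suc k) e ] (splitAt (#profile z k (suc e)) i)

#profile-zero : ∀ z → #profile z 0 0 ≡ 1
#profile-zero zero = refl
#profile-zero (suc z) = trans (+-identityʳ _) (#profile-zero z)

#profile-zero-suc : ∀ z e → #profile z 0 (suc e) ≡ 0
#profile-zero-suc zero e = refl
#profile-zero-suc (suc z) e = trans (+-identityʳ _) (#profile-zero-suc z e)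

#profile-suc : ∀ z k e → #profile z (suc k) e ≡ paths z (suc k) * paths k e
#profile⁺-suc : ∀ z k e → #profile⁺ z (suc k) e ≡ paths z k * paths k e
#profile-suc zero k e = #profile⁺-suc zero k e
#profile-suc (suc z) k e =
  trans (cong₂ _+_ (#profile-suc z k e) (#profile⁺-suc (suc z) k e))
        (sym (*-distribʳ-+ (paths k e) (paths z (suc k)) (paths (suc z) k)))
#profile⁺-suc z zero zero rewrite #profile-zero z | paths-zeroʳ z = refl
#profile⁺-suc z (suc k) zero rewrite #profile-suc z k zero | paths-zeroʳ k | paths-zeroʳ (suc k) = refl
#profile⁺-suc z zero (suc e) rewrite #profile-zero-suc z e = #profile⁺-suc z zero e
#profile⁺-suc z (suc k) (suc e) =
  trans (cong₂ _+_ (#profile-suc z k (suc e)) (#profile⁺-suc z (suc k) e))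
        (sym (*-distribˡ-+ (paths z (suc k)) (paths k (suc e)) (paths (suc k) e)))

enumerate-profile : ∀ z k e i → HasProfile z k e (enumerate z k e i)
enumerate⁺-profile : ∀ z k e i → HasProfile z (suc k) e (sucHead (enumerate⁺ z (suc k) e i))
enumerate-profile zero zero zero i = refl , refl , refl
enumerate-profile zero (suc k) e i = enumerate⁺-profile zero k e i
enumerate-profile (suc z) zero e i with splitAt (#profile z zero e) i
... | inj₁ j = let (l , s , c) = enumerate-profile z zero e j in cong suc l , s , cong suc c
enumerate-profile (suc z) (suc k) e i with splitAt (#profile z (suc k) e) i
... | inj₁ j = let (l , s , c) = enumerate-profile z (suc k) e j in cong suc l , s , cong suc c
... | inj₂ j = enumerate⁺-profile (suc z) k e j
enumerate⁺-profile z k zero i =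
  let (l , s , c) = enumerate-profile z k zero i in trans (cong suc l) (sym (+-suc z k)) , cong suc s , c
enumerate⁺-profile z k (suc e) i with splitAt (#profile z k (suc e)) i
... | inj₁ j = let (l , s , c) = enumerate-profile z k (suc e) j in trans (cong suc l) (sym (+-suc z k)) , cong suc s , c
... | inj₂ j = let (l , s , c) = enumerate⁺-profile z k e j in l , cong suc (trans s (sym (+-suc k e))) , c

module _ {A B C : Set} {f : A → C} {g : B → C} where

  [,]-injective : Injective _≡_ _≡_ f → Injective _≡_ _≡_ g → (∀ a b → f a ≢ g b) → Injective _≡_ _≡_ [ f , g ]
  [,]-injective f-inj g-inj f≢g {inj₁ a} {inj₁ a′} eq = cong inj₁ (f-inj eq)
  [,]-injective f-inj g-inj f≢g {inj₁ a} {inj₂ b′} eq = ⊥-elim (f≢g a b′ eq)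
  [,]-injective f-inj g-inj f≢g {inj₂ b} {inj₁ a′} eq = ⊥-elim (f≢g a′ b (sym eq))
  [,]-injective f-inj g-inj f≢g {inj₂ b} {inj₂ b′} eq = cong inj₂ (g-inj eq)

splitAt-injective : ∀ m {n} → Injective _≡_ _≡_ (splitAt m {n})
splitAt-injective m {n} {i} {j} eq = trans (sym (join-splitAt m n i)) (trans (cong (join m n) eq) (join-splitAt m n j))

sucHead-injective : Injective _≡_ _≡_ sucHead
sucHead-injective {h , t} {.h , .t} refl = refl

bumpHead-injective : Injective _≡_ _≡_ bumpHead
bumpHead-injective {h , t} {.h , .t} refl = refl

enumerate-injective : ∀ z k e → Injective _≡_ _≡_ (enumerate z k e)
enumerate⁺-injective : ∀ z k e → Injective _≡_ _≡_ (enumerate⁺ z k e)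
enumerate-injective zero zero zero {Fin.zero} {Fin.zero} _ = refl
enumerate-injective zero (suc k) e eq = enumerate⁺-injective zero (suc k) e (sucHead-injective eq)
enumerate-injective (suc z) k e eq = splitAt-injective (#profile z k e)
  ([,]-injective (enumerate-injective z k e ∘ proj₂ ∘ ∷-injective)
                 (enumerate⁺-injective (suc z) k e ∘ sucHead-injective)
                 (λ _ _ ()) eq)
enumerate⁺-injective z (suc k) zero eq = enumerate-injective z k zero (cong proj₂ eq)
enumerate⁺-injective z (suc k) (suc e) eq = splitAt-injective (#profile z k (suc e))
  ([,]-injective (enumerate-injective z k (suc e) ∘ cong proj₂)
                 (enumerate⁺-injective z (suc k) e ∘ bumpHead-injective)
                 (λ _ _ ()) eq)

sumBelow : (ℕ → ℕ) → ℕ → ℕ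
sumBelow f zero = 0
sumBelow f (suc m) = f 0 + sumBelow (f ∘ suc) m

sumBelow-cong : ∀ {f g : ℕ → ℕ} m → (∀ i → i < m → f i ≡ g i) → sumBelow f m ≡ sumBelow g m
sumBelow-cong zero eq = refl
sumBelow-cong (suc m) eq = cong₂ _+_ (eq 0 z<s) (sumBelow-cong m (λ i i<m → eq (suc i) (s<s i<m)))

sumBelow-suc : ∀ f m → sumBelow f (suc m) ≡ sumBelow f m + f m
sumBelow-suc f zero = +-comm (f 0) 0
sumBelow-suc f (suc m) = trans (cong (f 0 +_) (sumBelow-suc (f ∘ suc) m)) (sym (+-assoc (f 0) _ _))

sumBelow-+ : ∀ f t m → sumBelow f (t + m) ≡ sumBelow f t + sumBelow (λ i → f (t + i)) m
sumBelow-+ f zero m = refl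
sumBelow-+ f (suc t) m = trans (cong (f 0 +_) (sumBelow-+ (f ∘ suc) t m)) (sym (+-assoc (f 0) _ _))

rotate : ℕ → (ℕ → ℕ) → ℕ → ℕ → ℕ
rotate t X zero i = X i
rotate t X (suc u) zero = X t
rotate t X (suc u) (suc i) = rotate (suc t) X u i

rotate-< : ∀ t X u i → i < u → rotate t X u i ≡ X (t + i)
rotate-< t X (suc u) zero _ = cong X (sym (+-identityʳ t))
rotate-< t X (suc u) (suc i) (s<s i<u) = trans (rotate-< (suc t) X u i i<u) (cong X (sym (+-suc t i)))

rotate-+ : ∀ t X u i → rotate t X u (u + i) ≡ X i
rotate-+ t X zero i = refl
rotate-+ t X (suc u) i = rotate-+ (suc t) X u i

∘-rotate : ∀ (h : ℕ → ℕ) t X u i → h (rotate t X u i) ≡ rotate t (h ∘ X) u i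
∘-rotate h t X zero i = refl
∘-rotate h t X (suc u) zero = refl
∘-rotate h t X (suc u) (suc i) = ∘-rotate h (suc t) X u i

sumBelow-shift : ∀ (X : ℕ → ℕ) t m → sumBelow (λ i → X (t + suc i)) m ≡ sumBelow (λ i → X (suc t + i)) m
sumBelow-shift X t m = sumBelow-cong m (λ i _ → cong X (+-suc t i))

sumBelow-rotate-≤ : ∀ t X u l → l ≤ u → sumBelow (rotate t X u) l ≡ sumBelow (λ i → X (t + i)) l
sumBelow-rotate-≤ t X u zero _ = refl
sumBelow-rotate-≤ t X (suc u) (suc l) (s≤s l≤u) = begin
    X t + sumBelow (rotate (suc t) X u) l
  ≡⟨ cong (X t +_) (sumBelow-rotate-≤ (suc t) X u l l≤u) ⟩
    X t + sumBelow (λ i → X (suc t + i)) l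
  ≡⟨ cong₂ _+_ (cong X (sym (+-identityʳ t))) (sym (sumBelow-shift X t l)) ⟩
    X (t + 0) + sumBelow (λ i → X (t + suc i)) l
  ∎
  where open ≡-Reasoning

sumBelow-rotate : ∀ t X u m → sumBelow (rotate t X u) (u + m) ≡ sumBelow (λ i → X (t + i)) u + sumBelow X m
sumBelow-rotate t X zero m = refl
sumBelow-rotate t X (suc u) m = begin
    X t + sumBelow (rotate (suc t) X u) (u + m)
  ≡⟨ cong (X t +_) (sumBelow-rotate (suc t) X u m) ⟩
    X t + (sumBelow (λ i → X (suc t + i)) u + sumBelow X m)
  ≡⟨ +-assoc (X t) _ _ ⟨
    X t + sumBelow (λ i → X (suc t + i)) u + sumBelow X m
  ≡⟨ cong₂ (λ p q → p + q + sumBelow X m) (cong X (sym (+-identityʳ t))) (sym (sumBelow-shift X t u)) ⟩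
    X (t + 0) + sumBelow (λ i → X (t + suc i)) u + sumBelow X m
  ∎
  where open ≡-Reasoning

sumBelow-rotate-whole : ∀ t X u → sumBelow (rotate t X u) (t + u) ≡ sumBelow X (t + u)
sumBelow-rotate-whole t X u = begin
    sumBelow (rotate t X u) (t + u)              ≡⟨ cong (sumBelow (rotate t X u)) (+-comm t u) ⟩
    sumBelow (rotate t X u) (u + t)              ≡⟨ sumBelow-rotate t X u t ⟩
    sumBelow (λ i → X (t + i)) u + sumBelow X t  ≡⟨ +-comm _ (sumBelow X t) ⟩
    sumBelow X t + sumBelow (λ i → X (t + i)) u ≡⟨ sumBelow-+ X t u ⟨
    sumBelow X (t + u)                           ∎
  where open ≡-Reasoning

sumBelow-∘-rotate : ∀ (h : ℕ → ℕ) t X u → sumBelow (h ∘ rotate t X u) (t + u) ≡ sumBelow (h ∘ X) (t + u)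
sumBelow-∘-rotate h t X u =
  trans (sumBelow-cong (t + u) (λ i _ → ∘-rotate h t X u i)) (sumBelow-rotate-whole t (h ∘ X) u)

at : List ℕ → ℕ → ℕ
at [] _ = 0
at (x ∷ xs) zero = x
at (x ∷ xs) (suc i) = at xs i

sumBelow-at : ∀ xs → sumBelow (at xs) (length xs) ≡ sum xs
sumBelow-at [] = refl
sumBelow-at (x ∷ xs) = cong (x +_) (sumBelow-at xs)

sumBelow-isZero-at : ∀ xs → sumBelow (isZero ∘ at xs) (length xs) ≡ zeros xs
sumBelow-isZero-at [] = refl
sumBelow-isZero-at (x ∷ xs) = cong (isZero x +_) (sumBelow-isZero-at xs)

at-ext : ∀ xs ys → length xs ≡ length ys → (∀ i → i < length xs → at xs i ≡ at ys i) → xs ≡ ys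
at-ext [] [] _ _ = refl
at-ext (x ∷ xs) (y ∷ ys) len eq =
  cong₂ _∷_ (eq 0 z<s) (at-ext xs ys (suc-injective len) (λ i i< → eq (suc i) (s<s i<)))

rotate-cancel : ∀ t u X Y → (∀ l → l < t + u → rotate t X u l ≡ rotate t Y u l) → ∀ l → l < t + u → X l ≡ Y l
rotate-cancel t u X Y eq l l<t+u with t ≤? l
... | yes t≤l = begin
    X l            ≡⟨ cong X t+d≡l ⟨
    X (t + d)      ≡⟨ rotate-< t X u d d<u ⟨
    rotate t X u d ≡⟨ eq d (≤-<-trans (m∸n≤m l t) l<t+u) ⟩
    rotate t Y u d ≡⟨ rotate-< t Y u d d<u ⟩
    Y (t + d)      ≡⟨ cong Y t+d≡l ⟩
    Y l            ∎
  where
    open ≡-Reasoning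
    d = l ∸ t
    t+d≡l : t + d ≡ l
    t+d≡l = m+[n∸m]≡n t≤l
    d<u : d < u
    d<u = +-cancelˡ-< t d u (subst (_< t + u) (sym t+d≡l) l<t+u)
... | no t≰l = begin
    X l                  ≡⟨ rotate-+ t X u l ⟨
    rotate t X u (u + l) ≡⟨ eq (u + l) (subst (u + l <_) (+-comm u t) (+-monoʳ-< u (≰⇒> t≰l))) ⟩
    rotate t Y u (u + l) ≡⟨ rotate-+ t Y u l ⟩
    Y l                  ∎
  where open ≡-Reasoning

-- t is the leftmost minimiser of sumBelow X j − j over j ≤ K; the differences are compared
-- crosswise to avoid truncated subtraction.
LeftmostMinimum : (ℕ → ℕ) → ℕ → ℕ → Set
LeftmostMinimum X K t =
  t ≤ K
  × (∀ j → j ≤ K → sumBelow X t + j ≤ sumBelow X j + t)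
  × (∀ j → j < t → sumBelow X t + j < sumBelow X j + t)

leftmostMinimum : ∀ X K → ∃ (LeftmostMinimum X K)
leftmostMinimum X zero = 0 , z≤n , (λ { zero z≤n → ≤-refl }) , (λ _ ())
leftmostMinimum X (suc K) with leftmostMinimum X K
... | t , t≤K , min , strict with sumBelow X (suc K) + t <? sumBelow X t + suc K
... | yes K<t = suc K , ≤-refl , min′ , strict′
  where
    S = sumBelow X
    <-≤-chain : ∀ a b c t j K → a + t < b + K → b + j ≤ c + t → a + j < c + K
    <-≤-chain a b c t j K p q = +-cancelˡ-≤ (b + t) _ _ (subst₂ _≤_ (reorderˡ a b t j) (reorderʳ b K c t) (+-mono-≤ p q))
      where
        reorderˡ : ∀ a b t j → suc (a + t) + (b + j) ≡ (b + t) + suc (a + j)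
        reorderˡ = solve-∀
        reorderʳ : ∀ b K c t → (b + K) + (c + t) ≡ (b + t) + (c + K)
        reorderʳ = solve-∀
    strict′ : ∀ j → j < suc K → S (suc K) + j < S j + suc K
    strict′ j (s≤s j≤K) = <-≤-chain (S (suc K)) (S t) (S j) t j (suc K) K<t (min j j≤K)
    min′ : ∀ j → j ≤ suc K → S (suc K) + j ≤ S j + suc K
    min′ j j≤ with m≤n⇒m<n∨m≡n j≤
    ... | inj₁ j< = <⇒≤ (strict′ j j<)
    ... | inj₂ refl = ≤-refl
... | no K≮t = t , m≤n⇒m≤1+n t≤K , min′ , strict
  where
    min′ : ∀ j → j ≤ suc K → sumBelow X t + j ≤ sumBelow X j + t
    min′ j j≤ with m≤n⇒m<n∨m≡n j≤
    ... | inj₁ (s≤s j<) = min j j<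
    ... | inj₂ refl = ≮⇒≥ K≮t

Ballot : (ℕ → ℕ) → ℕ → Set
Ballot c n = (∀ l → l ≤ n → l ≤ sumBelow c l) × sumBelow c (suc n) ≡ n

module _ (X : ℕ → ℕ) (n t : ℕ) (total : sumBelow X (suc n) ≡ n) (lm : LeftmostMinimum X n t) where

  private
    S = sumBelow X
    u = suc n ∸ t
    t+u≡ : t + u ≡ suc n
    t+u≡ = m+[n∸m]≡n (m≤n⇒m≤1+n (proj₁ lm))

  rotate-prefix-unwrapped : ∀ l → l ≤ n → l ≤ u → l ≤ sumBelow (rotate t X u) l
  rotate-prefix-unwrapped l l≤n l≤u rewrite sumBelow-rotate-≤ t X u l l≤u
    with m≤n⇒m<n∨m≡n (subst (t + l ≤_) t+u≡ (+-monoʳ-≤ t l≤u))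
  ... | inj₁ (s≤s t+l≤n) =
    cancel (S t) t l _ (subst (λ w → S t + (t + l) ≤ w + t) (sumBelow-+ X t l) (proj₁ (proj₂ lm) (t + l) t+l≤n))
    where
      cancel : ∀ a t l s → a + (t + l) ≤ (a + s) + t → l ≤ s
      cancel a t l s p = +-cancelˡ-≤ (a + t) l s (subst₂ _≤_ (reorderˡ a t l) (reorderʳ a s t) p)
        where
          reorderˡ : ∀ a t l → a + (t + l) ≡ (a + t) + l
          reorderˡ = solve-∀
          reorderʳ : ∀ a s t → (a + s) + t ≡ (a + t) + s
          reorderʳ = solve-∀
  ... | inj₂ t+l≡ = atEnd (S t) _ (proj₂ (proj₂ lm) 0 0<t) (trans (sym (sumBelow-+ X t l)) (trans (cong S t+l≡) total))
    where
      0<t : 0 < t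
      0<t = n≢0⇒n>0 (λ t≡0 → <⇒≱ (subst (n <_) (trans (sym t+l≡) (cong (_+ l) t≡0)) ≤-refl) l≤n)
      atEnd : ∀ a s → a + 0 < t → a + s ≡ n → l ≤ s
      atEnd a s p r = +-cancelˡ-≤ a l s (subst (a + l ≤_) (sym r) (≤-pred (subst (suc (a + l) ≤_) t+l≡
        (subst₂ (λ x y → suc x + l ≤ y + l) (+-identityʳ a) refl (+-monoˡ-≤ l p)))))

  rotate-prefix-wrapped : ∀ l → l ≤ n → ¬ l ≤ u → l ≤ sumBelow (rotate t X u) l
  rotate-prefix-wrapped l l≤n l≰u =
    subst (_≤ sumBelow (rotate t X u) l) u+m≡l
      (subst (u + m ≤_) (sym (trans (cong (sumBelow (rotate t X u)) (sym u+m≡l)) (sumBelow-rotate t X u m)))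
        (wrapped (S t) m (S m) _ (proj₂ (proj₂ lm) m m<t) (trans (sym (sumBelow-+ X t u)) (trans (cong S t+u≡) total))))
    where
      m = l ∸ u
      u+m≡l : u + m ≡ l
      u+m≡l = m+[n∸m]≡n (<⇒≤ (≰⇒> l≰u))
      m<t : m < t
      m<t = +-cancelʳ-< u m t (subst (_< t + u) (+-comm u m)
        (subst (u + m <_) (sym t+u≡) (s≤s (subst (_≤ n) (sym u+m≡l) l≤n))))
      wrapped : ∀ a m b s → a + m < b + t → a + s ≡ n → u + m ≤ s + b
      wrapped a m b s p r = +-cancelˡ-≤ a (u + m) (s + b) (subst₂ _≤_ (reorderˡ a m u) reorderʳ
        (≤-pred (subst (suc (a + m + u) ≤_) b+t+u≡ (+-monoˡ-≤ u p))))
        where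
          reorderˡ : ∀ a m u → a + m + u ≡ a + (u + m)
          reorderˡ = solve-∀
          b+t+u≡ : b + t + u ≡ suc (b + n)
          b+t+u≡ = trans (+-assoc b t u) (trans (cong (b +_) t+u≡) (+-suc b n))
          shuffle : ∀ b a s → b + (a + s) ≡ a + (s + b)
          shuffle = solve-∀
          reorderʳ : b + n ≡ a + (s + b)
          reorderʳ = trans (cong (b +_) (sym r)) (shuffle b a s)

  rotate-ballot : Ballot (rotate t X u) n
  rotate-ballot = prefix , whole
    where
      open ≡-Reasoning
      prefix : ∀ l → l ≤ n → l ≤ sumBelow (rotate t X u) l
      prefix l l≤n with l ≤? u
      ... | yes l≤u = rotate-prefix-unwrapped l l≤n l≤u
      ... | no l≰u = rotate-prefix-wrapped l l≤n l≰u
      whole : sumBelow (rotate t X u) (suc n) ≡ n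
      whole = begin
        sumBelow (rotate t X u) (suc n)  ≡⟨ cong (sumBelow (rotate t X u)) t+u≡ ⟨
        sumBelow (rotate t X u) (t + u)  ≡⟨ sumBelow-rotate-whole t X u ⟩
        sumBelow X (t + u)               ≡⟨ cong (sumBelow X) t+u≡ ⟩
        sumBelow X (suc n)               ≡⟨ total ⟩
        n                                ∎

cycleLemma : ∀ X n → sumBelow X (suc n) ≡ n → ∃[ t ] (t ≤ n × Ballot (rotate t X (suc n ∸ t)) n)
cycleLemma X n total with leftmostMinimum X n
... | t , lm = t , proj₁ lm , rotate-ballot X n t total lm

<⇒<ᵇ≡true : ∀ {m n} → m < n → (m <ᵇ n) ≡ true
<⇒<ᵇ≡true m<n = Equivalence.to T-≡ (<⇒<ᵇ m<n)

≤⇒<ᵇ≡false : ∀ {m n} → n ≤ m → (m <ᵇ n) ≡ false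
≤⇒<ᵇ≡false {m} {n} n≤m with m <ᵇ n in eq
... | false = refl
... | true = ⊥-elim (<⇒≱ (<ᵇ⇒< m n (subst T (sym eq) tt)) n≤m)

toList-tabulate : ∀ m (g : ℕ → ℕ) → toList (tabulate {n = m} (g ∘ toℕ)) ≡ applyUpTo g m
toList-tabulate zero g = refl
toList-tabulate (suc m) g = cong (g 0 ∷_) (toList-tabulate m (g ∘ suc))

descents-applyUpTo : ∀ g m → descents (applyUpTo g (suc m)) ≡ sumBelow (λ j → if g (suc j) <ᵇ g j then 1 else 0) m
descents-applyUpTo g zero = refl
descents-applyUpTo g (suc m) = cong ((if g 1 <ᵇ g 0 then 1 else 0) +_) (descents-applyUpTo (g ∘ suc) m)

-- Consecutive entries differ by c (suc j) − 1: the array descends exactly at the zeros of c,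
-- and never by more than one.
staircase : ℕ → (ℕ → ℕ) → ℕ → ℕ
staircase n c j = sumBelow c (suc j) + (n ∸ suc j)

staircaseVec : ∀ n → (ℕ → ℕ) → Vec ℕ n
staircaseVec n c = tabulate (staircase n c ∘ toℕ)

module _ {n : ℕ} {c : ℕ → ℕ} (ballot : Ballot c n) where

  ballot-sum≡ : sumBelow c n ≡ n
  ballot-sum≡ = ≤-antisym
    (subst (sumBelow c n ≤_) (trans (sym (sumBelow-suc c n)) (proj₂ ballot)) (m≤m+n (sumBelow c n) (c n)))
    (proj₁ ballot n ≤-refl)

  ballot-last≡0 : c n ≡ 0
  ballot-last≡0 = +-cancelˡ-≡ n (c n) 0
    (trans (cong (_+ c n) (sym ballot-sum≡)) (trans (sym (sumBelow-suc c n)) (trans (proj₂ ballot) (sym (+-identityʳ n)))))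

  staircase-≥ : ∀ j → j < n → n ≤ staircase n c j
  staircase-≥ j j<n = subst (_≤ staircase n c j) (m+[n∸m]≡n j<n) (+-monoˡ-≤ (n ∸ suc j) (proj₁ ballot (suc j) j<n))

  staircase-recover : ∀ {c′} → Ballot c′ n → (∀ j → j < n → staircase n c j ≡ staircase n c′ j) →
    ∀ i → i ≤ n → c i ≡ c′ i
  staircase-recover {c′} ballot′ eq i i≤n = +-cancelˡ-≡ (sumBelow c i) (c i) (c′ i) (begin
      sumBelow c i + c i   ≡⟨ sumBelow-suc c i ⟨
      sumBelow c (suc i)   ≡⟨ prefixes (suc i) (s≤s i≤n) ⟩
      sumBelow c′ (suc i)  ≡⟨ sumBelow-suc c′ i ⟩
      sumBelow c′ i + c′ i ≡⟨ cong (_+ c′ i) (prefixes i (m≤n⇒m≤1+n i≤n)) ⟨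
      sumBelow c i + c′ i  ∎)
    where
      open ≡-Reasoning
      prefixes : ∀ k → k ≤ suc n → sumBelow c k ≡ sumBelow c′ k
      prefixes zero _ = refl
      prefixes (suc j) (s≤s j≤n) with m≤n⇒m<n∨m≡n j≤n
      ... | inj₁ j<n = +-cancelʳ-≡ (n ∸ suc j) (sumBelow c (suc j)) (sumBelow c′ (suc j)) (eq j j<n)
      ... | inj₂ refl = trans (proj₂ ballot) (sym (proj₂ ballot′))

module _ {n′ : ℕ} {c : ℕ → ℕ} (ballot : Ballot c (suc n′)) where

  staircase-last : staircase (suc n′) c n′ ≡ suc n′
  staircase-last = trans (cong (sumBelow c (suc n′) +_) (n∸n≡0 n′)) (trans (+-identityʳ _) (ballot-sum≡ ballot))

  staircase-step : ∀ j → suc j < suc n′ → staircase (suc n′) c j ≤ suc (staircase (suc n′) c (suc j))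
  staircase-step j j+1<n rewrite +-∸-assoc 1 (≤-pred j+1<n) | sumBelow-suc c (suc j) =
    subst (_≤ suc (sumBelow c (suc j) + c (suc j) + (n′ ∸ suc j))) (sym (+-suc (sumBelow c (suc j)) (n′ ∸ suc j)))
      (s≤s (+-monoˡ-≤ (n′ ∸ suc j) (m≤m+n (sumBelow c (suc j)) (c (suc j)))))

  staircase-descent : ∀ j → suc j < suc n′ →
    (if staircase (suc n′) c (suc j) <ᵇ staircase (suc n′) c j then 1 else 0) ≡ isZero (c (suc j))
  staircase-descent j j+1<n rewrite +-∸-assoc 1 (≤-pred j+1<n) | sumBelow-suc c (suc j) with c (suc j)
  ... | zero rewrite +-identityʳ (sumBelow c (suc j)) | +-suc (sumBelow c (suc j)) (n′ ∸ suc j) =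
    cong (if_then 1 else 0) (<⇒<ᵇ≡true (n<1+n (sumBelow c (suc j) + (n′ ∸ suc j))))
  ... | suc v rewrite +-suc (sumBelow c (suc j)) v | +-suc (sumBelow c (suc j)) (n′ ∸ suc j) =
    cong (if_then 1 else 0) (≤⇒<ᵇ≡false (s≤s (+-monoˡ-≤ (n′ ∸ suc j) (m≤m+n (sumBelow c (suc j)) v))))

  runs-staircase : runs (staircaseVec (suc n′) c) ≡ sumBelow (isZero ∘ c) (suc (suc n′))
  runs-staircase = begin
      runs (staircaseVec n c)
    ≡⟨ cong runsL (toList-tabulate n (staircase n c)) ⟩
      suc (descents (applyUpTo (staircase n c) n))
    ≡⟨ cong suc (descents-applyUpTo (staircase n c) n′) ⟩
      suc (sumBelow (λ j → if staircase n c (suc j) <ᵇ staircase n c j then 1 else 0) n′)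
    ≡⟨ cong suc (sumBelow-cong n′ (λ j j< → staircase-descent j (s<s j<))) ⟩
      suc (sumBelow (isZero ∘ c ∘ suc) n′)
    ≡⟨ +-comm 1 _ ⟩
      sumBelow (isZero ∘ c ∘ suc) n′ + isZero 0
    ≡⟨ cong (λ w → sumBelow (isZero ∘ c ∘ suc) n′ + isZero w) (ballot-last≡0 ballot) ⟨
      sumBelow (isZero ∘ c ∘ suc) n′ + isZero (c n)
    ≡⟨ sumBelow-suc (isZero ∘ c ∘ suc) n′ ⟨
      sumBelow (isZero ∘ c ∘ suc) n
    ≡⟨ cong (_+ sumBelow (isZero ∘ c ∘ suc) n) head-positive ⟨
      sumBelow (isZero ∘ c) (suc n)
    ∎
    where
      open ≡-Reasoning
      n = suc n′
      head-positive : isZero (c 0) ≡ 0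
      head-positive with c 0 | proj₁ ballot 1 (s≤s z≤n)
      ... | suc _ | _ = refl

rmq-leftmost : ∀ {n} {A : Vec ℕ n} {i j k} → IsRMQ A i j k →
  (∀ l → i Fin.≤ l → l Fin.≤ j → lookup A i ≤ lookup A l) → k ≡ i
rmq-leftmost {i = i} {k = k} ((i≤k , k≤j) , _ , leftmost) min with toℕ i <? toℕ k
... | yes i<k = ⊥-elim (<⇒≱ (leftmost i ≤-refl i<k) (min k i≤k k≤j))
... | no i≮k = toℕ-injective (≤-antisym (≮⇒≥ i≮k) i≤k)

AnswersRMQ : ∀ {n} → (ℕ → ℕ) → (Fin n → Fin n → Fin n) → Set
AnswersRMQ {n} a Q = ∀ i j → i Fin.≤ j → IsRMQ (tabulate {n = n} (a ∘ toℕ)) i j (Q i j)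

module _ {n} {Q : Fin n → Fin n → Fin n} {a a′ : ℕ → ℕ} (ans : AnswersRMQ a Q) (ans′ : AnswersRMQ a′ Q) where

  rmq-transfer : ∀ {j i} → j ≤ i → (i<n : i < n) → (∀ l → j ≤ l → l ≤ i → a′ j ≤ a′ l) → a j ≤ a i
  -- The shared answer to RMQ(j, i) is j, because a′ attains its minimum over [j, i] at j;
  -- as an answer for a, it is a minimum of a over [j, i].
  rmq-transfer {j} {i} j≤i i<n min′ =
    subst₂ (λ x y → a x ≤ a y) j≡ i≡ (subst₂ _≤_ (lookup-tab a fj) (lookup-tab a fi) aj≤ai)
    where
      fj = fromℕ< (≤-<-trans j≤i i<n)
      fi = fromℕ< i<n
      j≡ : toℕ fj ≡ j
      j≡ = toℕ-fromℕ< _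
      i≡ : toℕ fi ≡ i
      i≡ = toℕ-fromℕ< _
      fj≤fi : fj Fin.≤ fi
      fj≤fi = subst₂ _≤_ (sym j≡) (sym i≡) j≤i
      lookup-tab : ∀ b (l : Fin n) → lookup (tabulate (b ∘ toℕ)) l ≡ b (toℕ l)
      lookup-tab b l = lookup∘tabulate (b ∘ toℕ) l
      Q≡fj : Q fj fi ≡ fj
      Q≡fj = rmq-leftmost {A = tabulate (a′ ∘ toℕ)} (ans′ fj fi fj≤fi) λ l fj≤l l≤fi →
        subst₂ _≤_ (sym (trans (lookup-tab a′ fj) (cong a′ j≡))) (sym (lookup-tab a′ l))
          (min′ (toℕ l) (subst (_≤ toℕ l) j≡ fj≤l) (subst (toℕ l ≤_) i≡ l≤fi))
      aj≤ai : lookup (tabulate (a ∘ toℕ)) fj ≤ lookup (tabulate (a ∘ toℕ)) fi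
      aj≤ai = subst (λ k → lookup (tabulate (a ∘ toℕ)) k ≤ lookup (tabulate (a ∘ toℕ)) fi) Q≡fj
        (proj₁ (proj₂ (ans fj fi fj≤fi)) fi fj≤fi ≤-refl)

least-witness : ∀ {P : ℕ → Set} → Decidable P → ∀ {m} → P m → ∃[ i ] (i ≤ m × P i × (∀ l → l < i → ¬ P l))
least-witness P? {zero} p = 0 , z≤n , p , λ _ ()
least-witness P? {suc m} p with P? 0
... | yes p0 = 0 , z≤n , p0 , λ _ ()
... | no ¬p0 with least-witness (P? ∘ suc) {m} p
... | i , i≤m , pi , below = suc i , s≤s i≤m , pi , λ { zero _ → ¬p0 ; (suc l) (s≤s l<i) → below l l<i }

DropsByAtMostOne : (ℕ → ℕ) → ℕ → Set
DropsByAtMostOne a n = ∀ j → suc j < n → a j ≤ suc (a (suc j))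

LastIsMinimum : (ℕ → ℕ) → ℕ → Set
LastIsMinimum a n′ = ∀ j → j < suc n′ → a n′ ≤ a j

module _ {n′} {Q : Fin (suc n′) → Fin (suc n′) → Fin (suc n′)} {a a′ : ℕ → ℕ}
         (ans : AnswersRMQ a Q) (ans′ : AnswersRMQ a′ Q) (drops : DropsByAtMostOne a (suc n′))
         (last≡ : a n′ ≡ a′ n′) (lastMin′ : LastIsMinimum a′ n′) where

  -- If a′ j < a j, take the first i > j with a i < a j: since a drops by at most one, a′ attains
  -- its minimum over [j, i] at j, and rmq-transfer yields the contradiction a j ≤ a i.
  ≤-at-last-difference : ∀ j → j < suc n′ → (∀ l → j < l → l < suc n′ → a l ≡ a′ l) → a j ≤ a′ j
  ≤-at-last-difference j j<n agree = ≮⇒≥ a′j≮aj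
    where
      a′j≮aj : ¬ (a′ j < a j)
      a′j≮aj a′j<aj with least-witness (λ x → (j <? x) ×-dec (a x <? a j)) {n′} (j<n′ , an′<aj)
        where
          an′<aj : a n′ < a j
          an′<aj = ≤-<-trans (subst (_≤ a′ j) (sym last≡) (lastMin′ j j<n)) a′j<aj
          j<n′ : j < n′
          j<n′ with m≤n⇒m<n∨m≡n (≤-pred j<n)
          ... | inj₁ j<n′ = j<n′
          ... | inj₂ refl = ⊥-elim (<-irrefl refl an′<aj)
      ... | suc i , i+1≤n′ , (j<i+1 , ai+1<aj) , before =
        <⇒≱ ai+1<aj (rmq-transfer {a = a} {a′} ans ans′ (<⇒≤ j<i+1) (s≤s i+1≤n′) min′)
        where
          aj≤ai : a j ≤ a i
          aj≤ai with m≤n⇒m<n∨m≡n (≤-pred j<i+1)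
          ... | inj₁ j<i = ≮⇒≥ (λ ai<aj → before i ≤-refl (j<i , ai<aj))
          ... | inj₂ refl = ≤-refl
          min′ : ∀ l → j ≤ l → l ≤ suc i → a′ j ≤ a′ l
          min′ l j≤l l≤i+1 with m≤n⇒m<n∨m≡n j≤l
          ... | inj₂ refl = ≤-refl
          ... | inj₁ j<l with m≤n⇒m<n∨m≡n l≤i+1
          ...   | inj₁ l<i+1 = subst (a′ j ≤_) (agree l j<l (<-trans l<i+1 (s≤s i+1≤n′)))
                    (<⇒≤ (<-≤-trans a′j<aj (≮⇒≥ (λ al<aj → before l l<i+1 (j<l , al<aj)))))
          ...   | inj₂ refl = subst (a′ j ≤_) (agree (suc i) j<l (s≤s i+1≤n′))
                    (≤-pred (≤-trans a′j<aj (≤-trans aj≤ai (drops i (s≤s i+1≤n′)))))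

rmq-determines : ∀ {n′ Q} {a a′ : ℕ → ℕ} → AnswersRMQ a Q → AnswersRMQ a′ Q →
  DropsByAtMostOne a (suc n′) → DropsByAtMostOne a′ (suc n′) → LastIsMinimum a n′ → LastIsMinimum a′ n′ →
  a n′ ≡ a′ n′ → ∀ j → j < suc n′ → a j ≡ a′ j
rmq-determines {n′} {a = a} {a′} ans ans′ drops drops′ lastMin lastMin′ last≡ j j<n =
  fromDistance (suc n′) j j<n (m≤n+m (suc n′) j)
  where
    fromDistance : ∀ d j → j < suc n′ → suc n′ ≤ j + d → a j ≡ a′ j
    fromDistance zero j j<n n≤j = ⊥-elim (<⇒≱ j<n (subst (suc n′ ≤_) (+-identityʳ j) n≤j))
    fromDistance (suc d) j j<n n≤j+d = ≤-antisym
      (≤-at-last-difference ans ans′ drops last≡ lastMin′ j j<n later)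
      (≤-at-last-difference ans′ ans drops′ (sym last≡) lastMin j j<n (λ l j<l l<n → sym (later l j<l l<n)))
      where
        later : ∀ l → j < l → l < suc n′ → a l ≡ a′ l
        later l j<l l<n = fromDistance d l l<n (≤-trans n≤j+d (subst (_≤ l + d) (sym (+-suc j d)) (+-monoˡ-≤ d j<l)))

staircase-rmq-injective : ∀ {n′ c c′} {Q : Fin (suc n′) → Fin (suc n′) → Fin (suc n′)} →
  Ballot c (suc n′) → Ballot c′ (suc n′) →
  AnswersRMQ (staircase (suc n′) c) Q → AnswersRMQ (staircase (suc n′) c′) Q →
  ∀ i → i ≤ suc n′ → c i ≡ c′ i
staircase-rmq-injective {n′} {c} {c′} ballot ballot′ ans ans′ =
  staircase-recover ballot ballot′
    (rmq-determines ans ans′ (staircase-step ballot) (staircase-step ballot′)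
      (lastMinimum ballot) (lastMinimum ballot′) (trans (staircase-last ballot) (sym (staircase-last ballot′))))
  where
    lastMinimum : ∀ {d} → Ballot d (suc n′) → LastIsMinimum (staircase (suc n′) d) n′
    lastMinimum {d} ballot j j<n = subst (_≤ staircase (suc n′) d j) (sym (staircase-last ballot)) (staircase-≥ ballot j j<n)

bit : Bool → Fin 2
bit false = Fin.zero
bit true = Fin.suc Fin.zero

bit-injective : Injective _≡_ _≡_ bit
bit-injective {false} {false} _ = refl
bit-injective {true} {true} _ = refl

bits→Fin : ∀ {s} → Vec Bool s → Fin (2 ^ s)
bits→Fin Vec.[] = Fin.zero
bits→Fin (x Vec.∷ v) = combine (bit x) (bits→Fin v)

bits→Fin-injective : ∀ {s} → Injective _≡_ _≡_ (bits→Fin {s})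
bits→Fin-injective {x = Vec.[]} {Vec.[]} _ = refl
bits→Fin-injective {x = x Vec.∷ v} {y Vec.∷ w} eq with combine-injective (bit x) (bits→Fin v) (bit y) (bits→Fin w) eq
... | x≡y , v≡w = cong₂ Vec._∷_ (bit-injective x≡y) (bits→Fin-injective v≡w)

module LowerBound (a b s : ℕ) (enc : Vec ℕ (suc (a + b)) → Vec Bool s)
  (dec : Vec Bool s → Fin (suc (a + b)) → Fin (suc (a + b)) → Fin (suc (a + b)))
  (correct : ∀ A → runs A ≡ suc a → ∀ i j → i Fin.≤ j → IsRMQ A i j (dec (enc A) i j)) where

  n = suc (a + b)

  word : Fin (#profile (suc a) (suc b) a) → List ℕ
  word = enumerate (suc a) (suc b) a

  length-word : ∀ i → length (word i) ≡ suc n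
  length-word i = trans (proj₁ (enumerate-profile (suc a) (suc b) a i)) (cong suc (+-suc a b))

  sum-word : ∀ i → sumBelow (at (word i)) (suc n) ≡ n
  sum-word i = begin
    sumBelow (at (word i)) (suc n)            ≡⟨ cong (sumBelow (at (word i))) (length-word i) ⟨
    sumBelow (at (word i)) (length (word i))  ≡⟨ sumBelow-at (word i) ⟩
    sum (word i)                              ≡⟨ proj₁ (proj₂ (enumerate-profile (suc a) (suc b) a i)) ⟩
    suc (b + a)                               ≡⟨ cong suc (+-comm b a) ⟩
    n                                         ∎
    where open ≡-Reasoning

  zeros-word : ∀ i → sumBelow (isZero ∘ at (word i)) (suc n) ≡ suc a
  zeros-word i = begin
    sumBelow (isZero ∘ at (word i)) (suc n)            ≡⟨ cong (sumBelow (isZero ∘ at (word i))) (length-word i) ⟨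
    sumBelow (isZero ∘ at (word i)) (length (word i))  ≡⟨ sumBelow-isZero-at (word i) ⟩
    zeros (word i)                                     ≡⟨ proj₂ (proj₂ (enumerate-profile (suc a) (suc b) a i)) ⟩
    suc a                                              ∎
    where open ≡-Reasoning

  shift : Fin (#profile (suc a) (suc b) a) → ℕ
  shift i = proj₁ (cycleLemma (at (word i)) n (sum-word i))

  shift-≤ : ∀ i → shift i ≤ n
  shift-≤ i = proj₁ (proj₂ (cycleLemma (at (word i)) n (sum-word i)))

  shift+rest≡ : ∀ i → shift i + (suc n ∸ shift i) ≡ suc n
  shift+rest≡ i = m+[n∸m]≡n (m≤n⇒m≤1+n (shift-≤ i))

  ballotWord : Fin (#profile (suc a) (suc b) a) → ℕ → ℕ
  ballotWord i = rotate (shift i) (at (word i)) (suc n ∸ shift i)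

  ballotWord-ballot : ∀ i → Ballot (ballotWord i) n
  ballotWord-ballot i = proj₂ (proj₂ (cycleLemma (at (word i)) n (sum-word i)))

  array : Fin (#profile (suc a) (suc b) a) → Vec ℕ n
  array i = staircaseVec n (ballotWord i)

  runs-array : ∀ i → runs (array i) ≡ suc a
  runs-array i = begin
      runs (array i)
    ≡⟨ runs-staircase (ballotWord-ballot i) ⟩
      sumBelow (isZero ∘ ballotWord i) (suc n)
    ≡⟨ cong (sumBelow (isZero ∘ ballotWord i)) (shift+rest≡ i) ⟨
      sumBelow (isZero ∘ ballotWord i) (shift i + (suc n ∸ shift i))
    ≡⟨ sumBelow-∘-rotate isZero (shift i) (at (word i)) (suc n ∸ shift i) ⟩
      sumBelow (isZero ∘ at (word i)) (shift i + (suc n ∸ shift i))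
    ≡⟨ cong (sumBelow (isZero ∘ at (word i))) (shift+rest≡ i) ⟩
      sumBelow (isZero ∘ at (word i)) (suc n)
    ≡⟨ zeros-word i ⟩
      suc a
    ∎
    where open ≡-Reasoning

  code : Fin (#profile (suc a) (suc b) a) → Fin (suc n * 2 ^ s)
  code i = combine (fromℕ< (s≤s (shift-≤ i))) (bits→Fin (enc (array i)))

  code-injective : Injective _≡_ _≡_ code
  code-injective {i} {j} eq with combine-injective _ _ _ _ eq
  ... | shifts≡ , bits≡ = enumerate-injective (suc a) (suc b) a
    (at-ext (word i) (word j) (trans (length-word i) (sym (length-word j))) λ l l<len →
      rotate-cancel (shift i) (suc n ∸ shift i) (at (word i)) (at (word j)) rotations≡ l
        (subst (l <_) (trans (length-word i) (sym (shift+rest≡ i))) l<len))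
    where
      shift≡ : shift i ≡ shift j
      shift≡ = trans (sym (toℕ-fromℕ< _)) (trans (cong toℕ shifts≡) (toℕ-fromℕ< _))
      answers : ∀ k → AnswersRMQ (staircase n (ballotWord k)) (dec (enc (array k)))
      answers k = correct (array k) (runs-array k)
      answersⱼ : AnswersRMQ (staircase n (ballotWord j)) (dec (enc (array i)))
      answersⱼ = subst (AnswersRMQ (staircase n (ballotWord j)) ∘ dec) (sym (bits→Fin-injective bits≡)) (answers j)
      ballots≡ : ∀ l → l ≤ n → ballotWord i l ≡ ballotWord j l
      ballots≡ = staircase-rmq-injective (ballotWord-ballot i) (ballotWord-ballot j) (answers i) answersⱼ
      rotations≡ : ∀ l → l < shift i + (suc n ∸ shift i) →
        ballotWord i l ≡ rotate (shift i) (at (word j)) (suc n ∸ shift i) l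
      rotations≡ l l< = subst (λ t → ballotWord i l ≡ rotate t (at (word j)) (suc n ∸ t) l) (sym shift≡)
        (ballots≡ l (≤-pred (subst (l <_) (shift+rest≡ i) l<)))

  #profile-≤ : #profile (suc a) (suc b) a ≤ suc n * 2 ^ s
  #profile-≤ = injective⇒≤ code-injective

quotient-of-cross : ∀ N D X → suc N * D ≡ suc (suc N) * X → X ≡ suc N * (D ∸ X) × D ≡ suc (suc N) * (D ∸ X)
quotient-of-cross N D X cross = X≡ , D≡
  where
    open ≡-Reasoning
    X≡ : X ≡ suc N * (D ∸ X)
    X≡ = sym (begin
      suc N * (D ∸ X)            ≡⟨ *-distribˡ-∸ (suc N) D X ⟩
      suc N * D ∸ suc N * X      ≡⟨ cong (_∸ suc N * X) cross ⟩
      X + suc N * X ∸ suc N * X  ≡⟨ m+n∸n≡m X (suc N * X) ⟩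
      X                          ∎)
    D≡ : D ≡ suc (suc N) * (D ∸ X)
    D≡ = *-cancelˡ-≡ D _ (suc N) (begin
      suc N * D                          ≡⟨ cross ⟩
      suc (suc N) * X                    ≡⟨ cong (suc (suc N) *_) X≡ ⟩
      suc (suc N) * (suc N * (D ∸ X))    ≡⟨ x∙yz≈y∙xz (suc (suc N)) (suc N) (D ∸ X) ⟩
      suc N * (suc (suc N) * (D ∸ X))    ∎)

narayana≡paths : ∀ a b → narayana (suc (a + b)) (suc a) ≡ paths (suc a) b * paths a (suc b) / suc (a + b)
narayana≡paths a b = cong (_/ suc (a + b))
  (cong₂ _*_ (C≡paths (suc a) b) (trans (cong (_C a) (sym (+-suc a b))) (C≡paths a (suc b))))

paths-narayana : ∀ a b →
  paths (suc a) b * paths a (suc b) ≡ suc (a + b) * narayana (suc (a + b)) (suc a)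
  × paths (suc a) (suc b) * paths a b ≡ suc (suc (a + b)) * narayana (suc (a + b)) (suc a)
paths-narayana a b = subst (λ q → X ≡ suc (a + b) * q × D ≡ suc (suc (a + b)) * q) (sym narayana≡q) quotients
  where
    X = paths (suc a) b * paths a (suc b)
    D = paths (suc a) (suc b) * paths a b
    quotients = quotient-of-cross (a + b) D X (narayana-cross a b)
    narayana≡q : narayana (suc (a + b)) (suc a) ≡ D ∸ X
    narayana≡q = trans (narayana≡paths a b)
      (trans (cong (_/ suc (a + b)) (trans (proj₁ quotients) (*-comm (suc (a + b)) (D ∸ X)))) (m*n/n≡m (D ∸ X) (suc (a + b))))

#profile-narayana : ∀ a b → #profile (suc a) (suc b) a ≡ suc (suc (a + b)) * narayana (suc (a + b)) (suc a)
#profile-narayana a b = trans (#profile-suc (suc a) b a)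
  (trans (cong (paths (suc a) (suc b) *_) (paths-sym b a)) (proj₂ (paths-narayana a b)))

rmq-lower-bound : (n r : ℕ) → 1 ≤ r → r ≤ n →
  (s : ℕ) (enc : Vec ℕ n → Vec Bool s) (dec : Vec Bool s → Fin n → Fin n → Fin n) →
  (∀ (A : Vec ℕ n) → runs A ≡ r → ∀ (i j : Fin n) → i Fin.≤ j → IsRMQ A i j (dec (enc A) i j)) →
  narayana n r ≤ 2 ^ s
rmq-lower-bound n (suc a) _ r≤n s enc dec correct with m≤n⇒∃[o]m+o≡n r≤n
... | b , refl = *-cancelˡ-≤ (suc (suc (a + b)))
  (subst (_≤ suc (suc (a + b)) * 2 ^ s) (#profile-narayana a b) (LowerBound.#profile-≤ a b s enc dec correct))

binomial²≤n²*narayana : ∀ n r → 1 ≤ r → r ≤ n → (n C r) ^ 2 ≤ n ^ 2 * narayana n r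
binomial²≤n²*narayana n (suc a) _ r≤n with m≤n⇒∃[o]m+o≡n r≤n
... | b , refl = begin
    (N C suc a) ^ 2         ≡⟨ cong (_^ 2) (C≡paths (suc a) b) ⟩
    paths (suc a) b ^ 2     ≡⟨ cong (paths (suc a) b *_) (*-identityʳ _) ⟩
    v * v                   ≤⟨ *-monoʳ-≤ v v≤N*w ⟩
    v * (N * w)             ≡⟨ x∙yz≈y∙xz v N w ⟩
    N * (v * w)             ≡⟨ cong (N *_) (proj₁ (paths-narayana a b)) ⟩
    N * (N * narayana N (suc a))   ≡⟨ *-assoc N N _ ⟨
    N * N * narayana N (suc a)     ≡⟨ cong (λ x → N * x * narayana N (suc a)) (*-identityʳ N) ⟨
    N ^ 2 * narayana N (suc a)     ∎
  where
    open ≤-Reasoning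
    N = suc (a + b)
    v = paths (suc a) b
    w = paths a (suc b)
    v≤N*w : v ≤ N * w
    v≤N*w = begin
      v                   ≤⟨ m≤n*m v (suc a) ⟩
      suc a * v           ≡⟨ suc-*-paths-sucˡ a b ⟩
      N * paths a b       ≡⟨ suc-*-paths-sucʳ a b ⟨
      suc b * w           ≤⟨ *-monoˡ-≤ w (s≤s (m≤n+m b a)) ⟩
      N * w               ∎

mainTheorem4 : ((n r : ℕ) → 1 ≤ r → r ≤ n →
    (s : ℕ) (enc : Vec ℕ n → Vec Bool s) (dec : Vec Bool s → Fin n → Fin n → Fin n) →
    (∀ (A : Vec ℕ n) → runs A ≡ r → ∀ (i j : Fin n) → i Fin.≤ j → IsRMQ A i j (dec (enc A) i j)) →
    narayana n r ≤ 2 ^ s)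
    × ∃ (λ (c : ℕ) → (n r : ℕ) → 1 ≤ r → r ≤ n → (n C r) ^ 2 ≤ n ^ c * narayana n r)
mainTheorem4 = rmq-lower-bound , (2 , binomial²≤n²*narayana)
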